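{- (1) $[\![G,G]\!]=H_1\cap H_3=\{(x,x^{ -1})\mid x\in U\}$. (2) For every $n\geq2$, $H_{1,n}\cap H_{3,n}$ is isomorphic to $U_{n-1}$.
   Context: Let $T$ be the infinite regular rooted binary tree (vertices: finite words over $\{1,2\}$), $T_n$ the subtree of words of length at most $n$, $\Omega=\mathrm{Aut}(T)$ with the profinite topology, and $\pi_n:\Omega\to\mathrm{Aut}(T_n)$ restriction. Write elements of $\Omega$ as $(u,v)\tau$ with $u,v\in\Omega$ (actions on the two subtrees at level 1) and $\tau\in\{\mathrm{id},\sigma\}$, $\sigma=(\mathrm{id},\mathrm{id})\sigma$ the swap; $(u,v)$ means $(u,v)\mathrm{id}$; multiplication: $(x_1,x_2)\tau(y_1,y_2)\tau'=(x_1y_{\tau(1)},x_2y_{\tau(2)})\tau\tau'$. Let $a_1,a_2,a_3\in\Omega$ be the unique elements with $a_1=\sigma$, $a_2=(a_3^{ -1},a_2^{ -1})\sigma$, $a_3=(a_2,a_3)$, and $G$ the closed subgroup topologically generated by them; $[\![G,G]\!]$ is the closure of its commutator subgroup. For $i=1,2,3$, $H_i$ is the closed normal subgroup of $G$ generated by $a_i$; $U$ is the closed normal subgroup of $G$ generated by $a_2a_3^{ -1}$; $H_{i,n}=\pi_n(H_i)$, $U_n=\pi_n(U)$. -}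

module Defs where

open import Data.Bool using (Bool; true; false; _xor_)
open import Data.Fin using (Fin; zero; suc)
open import Data.List using (List; []; _∷_; length)
open import Data.Nat using (ℕ; _<_)
open import Data.Product using (Σ; _×_; _,_)
open import Data.Sum using (_⊎_)
open import Relation.Binary.PropositionalEquality using (_≡_)

-- Letters {1,2} of the tree: zero = 1, suc zero = 2.
Letter : Set
Letter = Fin 2

Word : Set
Word = List Letter

-- An element of Ω = Aut(T) is represented by its portrait: the label
-- (true = swap σ, false = id) at every vertex.  Portraits are in bijection
-- with Aut(T).  The element (u,v)τ has root label τ and sections u (at 1), v (at 2).
Ω : Set
Ω = Word → Bool

swapL : Letter → Letter
swapL zero = suc zero
swapL (suc zero) = zero

act : Bool → Letter → Letter
act false i = i
act true i = swapL i

sec : Ω → Letter → Ω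
sec g i w = g (i ∷ w)

-- (x1,x2)τ (y1,y2)τ' = (x1 y_τ(1), x2 y_τ(2)) ττ'
infixl 7 _·_
_·_ : Ω → Ω → Ω
(g · h) [] = g [] xor h []
(g · h) (i ∷ w) = (sec g i · sec h (act (g []) i)) w

-- ((x1,x2)τ)⁻¹ = (x_τ(1)⁻¹, x_τ(2)⁻¹)τ
inv : Ω → Ω
inv g [] = g []
inv g (i ∷ w) = inv (sec g (act (g []) i)) w

e : Ω
e _ = false

pair : Ω → Ω → Ω
pair u v [] = false
pair u v (zero ∷ w) = u w
pair u v (suc zero ∷ w) = v w

_≈_ : Ω → Ω → Set
g ≈ h = ∀ w → g w ≡ h w

-- π_n g = π_n h : the portraits agree on all vertices of depth < n
_≈[_]_ : Ω → ℕ → Ω → Set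
g ≈[ n ] h = ∀ w → length w < n → g w ≡ h w

-- The generators.  a1 = σ, a2 = (a3⁻¹,a2⁻¹)σ, a3 = (a2,a3).
-- a2i, a3i are the inverses of a2, a3, computed from the recursions:
-- a2⁻¹ = (a2,a3)σ, a3⁻¹ = (a2⁻¹,a3⁻¹).
a1 : Ω
a1 [] = true
a1 (_ ∷ _) = false

a2 a2i a3 a3i : Ω
a2 [] = true
a2 (zero ∷ w) = a3i w
a2 (suc zero ∷ w) = a2i w
a2i [] = true
a2i (zero ∷ w) = a2 w
a2i (suc zero ∷ w) = a3 w
a3 [] = false
a3 (zero ∷ w) = a2 w
a3 (suc zero ∷ w) = a3 w
a3i [] = false
a3i (zero ∷ w) = a2i w
a3i (suc zero ∷ w) = a3i w

Subset : Set₁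
Subset = Ω → Set

data Gen (S : Subset) : Subset where
  gen : ∀ {g} → S g → Gen S g
  one : Gen S e
  mul : ∀ {g h} → Gen S g → Gen S h → Gen S (g · h)
  neg : ∀ {g} → Gen S g → Gen S (inv g)

-- closure in the profinite topology (basic neighbourhoods: level stabiliser cosets)
cl : Subset → Subset
cl S g = ∀ n → Σ Ω λ h → S h × g ≈[ n ] h

Gens : Subset
Gens g = g ≡ a1 ⊎ (g ≡ a2 ⊎ g ≡ a3)

G : Subset
G = cl (Gen Gens)

Conj : Ω → Subset
Conj a g = Σ Ω λ h → G h × g ≡ h · a · inv h

NCl : Ω → Subset
NCl a = cl (Gen (Conj a))

H1 H2 H3 U : Subset
H1 = NCl a1
H2 = NCl a2
H3 = NCl a3
U = NCl (a2 · inv a3)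

Comm : Subset
Comm g = Σ Ω λ h → Σ Ω λ k → G h × G k × g ≡ inv h · inv k · h · k

DerG : Subset
DerG = cl (Gen Comm)

_∩_ : Subset → Subset → Subset
(A ∩ B) g = A g × B g

SameSet : Subset → Subset → Set
SameSet A B = ∀ g → (A g → B g) × (B g → A g)

-- π_n(H), as the set of representatives in Ω of its elements (mod ≈[ n ])
Proj : ℕ → Subset → Subset
Proj n H g = Σ Ω λ h → H h × g ≈[ n ] h

-- group isomorphism between the subgroup A of Aut(T_n) and B of Aut(T_m),
-- both given by representatives in Ω, modulo ≈[ n ] resp. ≈[ m ]
IsoSub : ℕ → ℕ → Subset → Subset → Set
IsoSub n m A B = Σ (Ω → Ω) λ f →
  (∀ g h → A g → A h → (g ≈[ n ] h → f g ≈[ m ] f h) × (f g ≈[ m ] f h → g ≈[ n ] h)) ×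
  (∀ g → A g → B (f g)) ×
  (∀ g h → A g → A h → f (g · h) ≈[ m ] (f g · f h)) ×
  (∀ y → B y → Σ Ω λ g → A g × f g ≈[ m ] y)

DiagU : Subset
DiagU g = Σ Ω λ x → U x × g ≈ pair x (inv x)

{-# OPTIONS --safe #-}
module Submission where

-- G is the closure of a self-similar copy of the wallpaper group Γ = ℤ[i] ⋊ ⟨i⟩: the
-- portrait map Φ, built from the virtual endomorphism ψ (division by ϖ = -1 - i on the
-- index-two subgroup Kernel τ), is a homomorphism sending α₁, α₂, α₃ to a1, a2, a3.
-- Hence every element of H1, H3, U and [[G,G]] agrees at each level with the image of
-- an element of the kernel of a character of Γ (χ₁, τ, the rotation part, and the
-- rotation part together with the residue mod ϖ), while conversely Φ maps the translations
-- (even translations) into the subgroups generated by the corresponding conjugates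
-- (commutators).  Kernel χ₁ ∩ Kernel τ is the lattice ϖℤ[i] of even translations, which
-- is [Γ,Γ], so [[G,G]], H1 ∩ H3 and {(x, x⁻¹)} are all the closure of Φ(ϖℤ[i]); the
-- translation by ϖw has sections w and -w on the first level, which also yields the
-- isomorphism g ↦ g|₁ at each finite level.

open import Defs
open import Data.Nat using (ℕ; _≤_; _∸_)
open import Data.Product using (_×_)

open import Algebra.Bundles using (Group; AbelianGroup; CommutativeRing)
open import Algebra.Consequences.Propositional using (comm∧idˡ⇒idʳ; comm∧invˡ⇒invʳ; comm∧assoc⇒middleFour)
open import Algebra.Structures using (IsGroup; IsAbelianGroup)
open import Data.Bool using (Bool; true; false; not; _xor_)
open import Data.Bool.Properties using (xor-same; xor-comm; xor-assoc; xor-∧-commutativeRing)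
open import Data.Empty using (⊥-elim)
open import Data.Fin using (zero; suc)
open import Data.Integer using (ℤ; +_; -[1+_]; _+_; _*_; -_; _-_; 0ℤ; 1ℤ)
open import Data.Integer.Properties
  using (+-assoc; +-identityˡ; +-identityʳ; +-inverseˡ; +-inverseʳ; *-cancelˡ-≡; +-injective; neg-involutive; neg-distrib-+)
open import Data.Integer.Tactic.RingSolver using (solve-∀)
open import Data.List using ([]; _∷_; length)
import Data.Nat as ℕ
open import Data.Nat using (zero; suc; ⌊_/2⌋; s≤s; z≤n)
import Data.Nat.Properties as ℕ
open import Data.Nat.Properties using (m+1+n≢0; suc-injective)
open import Data.Product using (Σ; _,_; proj₁; proj₂)
open import Data.Sum using (inj₁; inj₂)
open import Data.Unit using (⊤; tt)
open import Function using (_∘_)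
open import Level using (0ℓ)
open import Relation.Binary.PropositionalEquality
  using (_≡_; _≢_; refl; sym; trans; cong; cong₂; subst; module ≡-Reasoning)
open import Relation.Binary.PropositionalEquality.Algebra using (isMagma)

bit : Bool → ℤ
bit false = 0ℤ
bit true  = 1ℤ

oddℕ : ℕ → Bool
oddℕ 0             = false
oddℕ 1             = true
oddℕ (suc (suc n)) = oddℕ n

odd : ℤ → Bool
odd (+ n)    = oddℕ n
odd -[1+ n ] = not (oddℕ n)

half : ℤ → ℤ
half (+ n)    = + ⌊ n /2⌋
half -[1+ n ] = -[1+ ⌊ n /2⌋ ]

n≡half+half+bit : ∀ n → + n ≡ half (+ n) + half (+ n) + bit (oddℕ n)
n≡half+half+bit 0             = refl
n≡half+half+bit 1             = refl
n≡half+half+bit (suc (suc n)) =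
  trans (cong (λ m → + 1 + (+ 1 + m)) (n≡half+half+bit n)) (regroup (half (+ n)) (bit (oddℕ n)))
  where
  regroup : ∀ h b → + 1 + (+ 1 + (h + h + b)) ≡ (+ 1 + h) + (+ 1 + h) + b
  regroup = solve-∀

bit-not : ∀ b → bit (not b) ≡ 1ℤ - bit b
bit-not false = refl
bit-not true  = refl

a≡half+half+bit : ∀ a → a ≡ half a + half a + bit (odd a)
a≡half+half+bit (+ n)    = n≡half+half+bit n
a≡half+half+bit a@(-[1+ n ]) = begin
  - (+ 1 + + n)                       ≡⟨ cong (λ m → - (+ 1 + m)) (n≡half+half+bit n) ⟩
  - (+ 1 + (h + h + bit (oddℕ n)))    ≡⟨ negate h (bit (oddℕ n)) ⟩
  half a + half a + (1ℤ - bit (oddℕ n)) ≡⟨ cong (λ b → half a + half a + b) (bit-not (oddℕ n)) ⟨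
  half a + half a + bit (odd a)        ∎
  where
  open ≡-Reasoning
  h = half (+ n)
  negate : ∀ h b → - (+ 1 + (h + h + b)) ≡ - (+ 1 + h) + - (+ 1 + h) + (1ℤ - b)
  negate = solve-∀

double-injective : ∀ a b → a + a ≡ b + b → a ≡ b
double-injective a b eq = *-cancelˡ-≡ (+ 2) a b (trans (double a) (trans eq (sym (double b))))
  where
  double : ∀ a → + 2 * a ≡ a + a
  double = solve-∀

double≢1 : ∀ a → a + a ≢ 1ℤ
double≢1 (+ 0)     ()
double≢1 (+ suc n) eq = m+1+n≢0 n (suc-injective (+-injective eq))
double≢1 -[1+ n ]  ()

bit-unique : ∀ h h′ b b′ → h + h + bit b ≡ h′ + h′ + bit b′ → b ≡ b′
bit-unique h h′ false false eq = refl
bit-unique h h′ true  true  eq = refl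
bit-unique h h′ false true  eq = sym (bit-unique h′ h true false (sym eq))
bit-unique h h′ true  false eq = ⊥-elim (double≢1 (h′ - h) (begin
  (h′ - h) + (h′ - h)     ≡⟨ expand h h′ ⟩
  (h′ + h′ + 0ℤ) - (h + h) ≡⟨ cong (_- (h + h)) eq ⟨
  (h + h + 1ℤ) - (h + h)   ≡⟨ cancel h ⟩
  1ℤ                       ∎))
  where
  open ≡-Reasoning
  expand : ∀ h h′ → (h′ - h) + (h′ - h) ≡ (h′ + h′ + 0ℤ) - (h + h)
  expand = solve-∀
  cancel : ∀ h → (h + h + 1ℤ) - (h + h) ≡ 1ℤ
  cancel = solve-∀

bit-+ : ∀ x y → Σ ℤ λ k → bit x + bit y ≡ k + k + bit (x xor y)
bit-+ false false = 0ℤ , refl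
bit-+ false true  = 0ℤ , refl
bit-+ true  false = 0ℤ , refl
bit-+ true  true  = 1ℤ , refl

odd-+ : ∀ a b → odd (a + b) ≡ odd a xor odd b
odd-+ a b with bit-+ (odd a) (odd b)
... | k , carry = bit-unique (half (a + b)) (x + k) (odd (a + b)) (odd a xor odd b) (begin
  half (a + b) + half (a + b) + bit (odd (a + b))  ≡⟨ a≡half+half+bit (a + b) ⟨
  a + b                                            ≡⟨ cong₂ _+_ (a≡half+half+bit a) (a≡half+half+bit b) ⟩
  (half a + half a + p) + (half b + half b + q)    ≡⟨ regroup (half a) (half b) p q ⟩
  x + x + (bit (odd a) + bit (odd b))              ≡⟨ cong (λ c → x + x + c) carry ⟩
  x + x + (k + k + bit (odd a xor odd b))          ≡⟨ absorb x k (bit (odd a xor odd b)) ⟩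
  (x + k) + (x + k) + bit (odd a xor odd b)        ∎)
  where
  open ≡-Reasoning
  x = half a + half b
  p = bit (odd a)
  q = bit (odd b)
  regroup : ∀ x y b c → (x + x + b) + (y + y + c) ≡ (x + y) + (x + y) + (b + c)
  regroup = solve-∀
  absorb : ∀ x k b → x + x + (k + k + b) ≡ (x + k) + (x + k) + b
  absorb = solve-∀

xor≡false⇒≡ : ∀ {x y} → x xor y ≡ false → x ≡ y
xor≡false⇒≡ {false} {false} _ = refl
xor≡false⇒≡ {true}  {true}  _ = refl

odd-neg : ∀ a → odd (- a) ≡ odd a
odd-neg a = xor≡false⇒≡ (trans (sym (odd-+ (- a) a)) (cong odd (+-inverseˡ a)))

odd-double : ∀ a → odd (a + a) ≡ false
odd-double a = trans (odd-+ a a) (xor-same (odd a))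

half-even : ∀ a → odd a ≡ false → half a + half a ≡ a
half-even a even = sym (trans (a≡half+half+bit a) (trans (cong (λ b → half a + half a + bit b) even) (+-identityʳ _)))

half-double : ∀ a → half (a + a) ≡ a
half-double a = double-injective (half (a + a)) a (half-even (a + a) (odd-double a))

-- The wallpaper group Γ = ℤ[i] ⋊ ⟨i⟩

data Quarter : Set where
  q0 q1 q2 q3 : Quarter

toℕ : Quarter → ℕ
toℕ q0 = 0
toℕ q1 = 1
toℕ q2 = 2
toℕ q3 = 3

fromℕ : ℕ → Quarter
fromℕ 0                         = q0
fromℕ 1                         = q1
fromℕ 2                         = q2
fromℕ 3                         = q3
fromℕ (suc (suc (suc (suc n)))) = fromℕ n

infixl 6 _⊕_
_⊕_ : Quarter → Quarter → Quarter
k ⊕ l = fromℕ (toℕ k ℕ.+ toℕ l)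

⊖_ : Quarter → Quarter
⊖ q0 = q0
⊖ q1 = q3
⊖ q2 = q2
⊖ q3 = q1

fromℕ-toℕ : ∀ k → fromℕ (toℕ k) ≡ k
fromℕ-toℕ q0 = refl
fromℕ-toℕ q1 = refl
fromℕ-toℕ q2 = refl
fromℕ-toℕ q3 = refl

fromℕ-+ : ∀ m n → fromℕ (toℕ (fromℕ m) ℕ.+ n) ≡ fromℕ (m ℕ.+ n)
fromℕ-+ 0                         n = refl
fromℕ-+ 1                         n = refl
fromℕ-+ 2                         n = refl
fromℕ-+ 3                         n = refl
fromℕ-+ (suc (suc (suc (suc m)))) n = fromℕ-+ m n

⊕-comm : ∀ k l → k ⊕ l ≡ l ⊕ k
⊕-comm k l = cong fromℕ (ℕ.+-comm (toℕ k) (toℕ l))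

⊕-assoc : ∀ k l m → (k ⊕ l) ⊕ m ≡ k ⊕ (l ⊕ m)
⊕-assoc k l m = begin
  fromℕ (toℕ (fromℕ (toℕ k ℕ.+ toℕ l)) ℕ.+ toℕ m)  ≡⟨ fromℕ-+ (toℕ k ℕ.+ toℕ l) (toℕ m) ⟩
  fromℕ (toℕ k ℕ.+ toℕ l ℕ.+ toℕ m)                ≡⟨ cong fromℕ (ℕ.+-assoc (toℕ k) (toℕ l) (toℕ m)) ⟩
  fromℕ (toℕ k ℕ.+ (toℕ l ℕ.+ toℕ m))              ≡⟨ cong fromℕ (ℕ.+-comm (toℕ k) _) ⟩
  fromℕ ((toℕ l ℕ.+ toℕ m) ℕ.+ toℕ k)              ≡⟨ fromℕ-+ (toℕ l ℕ.+ toℕ m) (toℕ k) ⟨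
  (l ⊕ m) ⊕ k                                      ≡⟨ ⊕-comm (l ⊕ m) k ⟩
  k ⊕ (l ⊕ m)                                      ∎
  where open ≡-Reasoning

⊕-identityˡ : ∀ k → q0 ⊕ k ≡ k
⊕-identityˡ = fromℕ-toℕ

⊕-identityʳ : ∀ k → k ⊕ q0 ≡ k
⊕-identityʳ = comm∧idˡ⇒idʳ ⊕-comm ⊕-identityˡ

⊕-inverseˡ : ∀ k → ⊖ k ⊕ k ≡ q0
⊕-inverseˡ q0 = refl
⊕-inverseˡ q1 = refl
⊕-inverseˡ q2 = refl
⊕-inverseˡ q3 = refl

⊕-inverseʳ : ∀ k → k ⊕ ⊖ k ≡ q0
⊕-inverseʳ = comm∧invˡ⇒invʳ {_⁻¹ = ⊖_} ⊕-comm ⊕-inverseˡ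

⊕-isAbelianGroup : IsAbelianGroup _≡_ _⊕_ q0 ⊖_
⊕-isAbelianGroup = record
  { isGroup = record
    { isMonoid = record
      { isSemigroup = record { isMagma = isMagma _⊕_ ; assoc = ⊕-assoc }
      ; identity    = ⊕-identityˡ , ⊕-identityʳ
      }
    ; inverse = ⊕-inverseˡ , ⊕-inverseʳ
    ; ⁻¹-cong = cong ⊖_
    }
  ; comm = ⊕-comm
  }

⊕-abelianGroup : AbelianGroup 0ℓ 0ℓ
⊕-abelianGroup = record { isAbelianGroup = ⊕-isAbelianGroup }

V : Set
V = ℤ × ℤ

infixl 6 _+ᵥ_
_+ᵥ_ : V → V → V
(a , b) +ᵥ (c , d) = (a + c , b + d)

-ᵥ_ : V → V
-ᵥ (a , b) = (- a , - b)

0ᵥ : V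
0ᵥ = (0ℤ , 0ℤ)

+ᵥ-assoc : ∀ u v w → (u +ᵥ v) +ᵥ w ≡ u +ᵥ (v +ᵥ w)
+ᵥ-assoc (a , b) (c , d) (e , f) = cong₂ _,_ (+-assoc a c e) (+-assoc b d f)

+ᵥ-identityˡ : ∀ v → 0ᵥ +ᵥ v ≡ v
+ᵥ-identityˡ (a , b) = cong₂ _,_ (+-identityˡ a) (+-identityˡ b)

+ᵥ-identityʳ : ∀ v → v +ᵥ 0ᵥ ≡ v
+ᵥ-identityʳ (a , b) = cong₂ _,_ (+-identityʳ a) (+-identityʳ b)

+ᵥ-inverseˡ : ∀ v → -ᵥ v +ᵥ v ≡ 0ᵥ
+ᵥ-inverseˡ (a , b) = cong₂ _,_ (+-inverseˡ a) (+-inverseˡ b)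

+ᵥ-inverseʳ : ∀ v → v +ᵥ -ᵥ v ≡ 0ᵥ
+ᵥ-inverseʳ (a , b) = cong₂ _,_ (+-inverseʳ a) (+-inverseʳ b)

+ᵥ-interchange : ∀ u v w x → (u +ᵥ v) +ᵥ (w +ᵥ x) ≡ (u +ᵥ w) +ᵥ (v +ᵥ x)
+ᵥ-interchange (a , b) (c , d) (e , f) (g , h) =
  cong₂ _,_ (+-interchange a c e g) (+-interchange b d f h)
  where
  +-interchange : ∀ a c e g → (a + c) + (e + g) ≡ (a + e) + (c + g)
  +-interchange = solve-∀

rot₁ : V → V
rot₁ (x , y) = (- y , x)

turn : ℕ → V → V
turn zero    v = v
turn (suc n) v = rot₁ (turn n v)

rot : Quarter → V → V
rot k = turn (toℕ k)

turn-+ : ∀ m n v → turn (m ℕ.+ n) v ≡ turn m (turn n v)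
turn-+ zero    n v = refl
turn-+ (suc m) n v = cong rot₁ (turn-+ m n v)

turn-fromℕ : ∀ m v → turn (toℕ (fromℕ m)) v ≡ turn m v
turn-fromℕ 0                         v = refl
turn-fromℕ 1                         v = refl
turn-fromℕ 2                         v = refl
turn-fromℕ 3                         v = refl
turn-fromℕ (suc (suc (suc (suc m)))) v = trans (turn-fromℕ m v) (sym (full-turn (turn m v)))
  where
  full-turn : ∀ v → turn 4 v ≡ v
  full-turn (x , y) = cong₂ _,_ (neg-involutive x) (neg-involutive y)

rot-⊕ : ∀ k l v → rot k (rot l v) ≡ rot (l ⊕ k) v
rot-⊕ k l v = begin
  turn (toℕ k) (turn (toℕ l) v)         ≡⟨ turn-+ (toℕ k) (toℕ l) v ⟨
  turn (toℕ k ℕ.+ toℕ l) v              ≡⟨ cong (λ n → turn n v) (ℕ.+-comm (toℕ k) (toℕ l)) ⟩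
  turn (toℕ l ℕ.+ toℕ k) v              ≡⟨ turn-fromℕ (toℕ l ℕ.+ toℕ k) v ⟨
  rot (l ⊕ k) v                         ∎
  where open ≡-Reasoning

rot-commute : (f : V → V) → (∀ v → f (rot₁ v) ≡ rot₁ (f v)) → ∀ k v → f (rot k v) ≡ rot k (f v)
rot-commute f f-rot₁ k v = go (toℕ k)
  where
  go : ∀ n → f (turn n v) ≡ turn n (f v)
  go zero    = refl
  go (suc n) = trans (f-rot₁ (turn n v)) (cong rot₁ (go n))

rot-+ᵥ : ∀ k v w → rot k (v +ᵥ w) ≡ rot k v +ᵥ rot k w
rot-+ᵥ k v w = go (toℕ k)
  where
  rot₁-+ᵥ : ∀ v w → rot₁ (v +ᵥ w) ≡ rot₁ v +ᵥ rot₁ w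
  rot₁-+ᵥ (a , b) (c , d) = cong (_, a + c) (neg-distrib-+ b d)
  go : ∀ n → turn n (v +ᵥ w) ≡ turn n v +ᵥ turn n w
  go zero    = refl
  go (suc n) = trans (cong rot₁ (go n)) (rot₁-+ᵥ (turn n v) (turn n w))

rot-0ᵥ : ∀ k → rot k 0ᵥ ≡ 0ᵥ
rot-0ᵥ k = sym (rot-commute (λ _ → 0ᵥ) (λ _ → refl) k 0ᵥ)

rot-neg : ∀ k v → rot k (-ᵥ v) ≡ -ᵥ rot k v
rot-neg k v = sym (rot-commute -ᵥ_ (λ _ → refl) k v)

-- (k , v) stands for the affine map z ↦ iᵏ z + v of ℤ[i], maps being composed from
-- left to right.
Γ : Set
Γ = Quarter × V

infixl 7 _∙_
_∙_ : Γ → Γ → Γ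
(k , v) ∙ (l , w) = (k ⊕ l , rot l v +ᵥ w)

ε : Γ
ε = (q0 , 0ᵥ)

infix 8 _⁻¹
_⁻¹ : Γ → Γ
(k , v) ⁻¹ = (⊖ k , -ᵥ rot (⊖ k) v)

∙-assoc : ∀ a b c → (a ∙ b) ∙ c ≡ a ∙ (b ∙ c)
∙-assoc (k , u) (l , v) (m , w) = cong₂ _,_ (⊕-assoc k l m) (begin
  rot m (rot l u +ᵥ v) +ᵥ w              ≡⟨ cong (_+ᵥ w) (rot-+ᵥ m (rot l u) v) ⟩
  (rot m (rot l u) +ᵥ rot m v) +ᵥ w      ≡⟨ cong (λ x → (x +ᵥ rot m v) +ᵥ w) (rot-⊕ m l u) ⟩
  (rot (l ⊕ m) u +ᵥ rot m v) +ᵥ w        ≡⟨ +ᵥ-assoc (rot (l ⊕ m) u) (rot m v) w ⟩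
  rot (l ⊕ m) u +ᵥ (rot m v +ᵥ w)        ∎)
  where open ≡-Reasoning

∙-identityˡ : ∀ a → ε ∙ a ≡ a
∙-identityˡ (k , v) = cong₂ _,_ (⊕-identityˡ k) (trans (cong (_+ᵥ v) (rot-0ᵥ k)) (+ᵥ-identityˡ v))

∙-identityʳ : ∀ a → a ∙ ε ≡ a
∙-identityʳ (k , v) = cong₂ _,_ (⊕-identityʳ k) (+ᵥ-identityʳ v)

∙-inverseˡ : ∀ a → a ⁻¹ ∙ a ≡ ε
∙-inverseˡ (k , v) = cong₂ _,_ (⊕-inverseˡ k) (begin
  rot k (-ᵥ rot (⊖ k) v) +ᵥ v    ≡⟨ cong (_+ᵥ v) (rot-neg k (rot (⊖ k) v)) ⟩
  -ᵥ rot k (rot (⊖ k) v) +ᵥ v    ≡⟨ cong (λ u → -ᵥ u +ᵥ v) (rot-⊕ k (⊖ k) v) ⟩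
  -ᵥ rot (⊖ k ⊕ k) v +ᵥ v        ≡⟨ cong (λ l → -ᵥ rot l v +ᵥ v) (⊕-inverseˡ k) ⟩
  -ᵥ v +ᵥ v                      ≡⟨ +ᵥ-inverseˡ v ⟩
  0ᵥ                             ∎)
  where open ≡-Reasoning

∙-inverseʳ : ∀ a → a ∙ a ⁻¹ ≡ ε
∙-inverseʳ (k , v) = cong₂ _,_ (⊕-inverseʳ k) (+ᵥ-inverseʳ (rot (⊖ k) v))

Γ-isGroup : IsGroup _≡_ _∙_ ε _⁻¹
Γ-isGroup = record
  { isMonoid = record
    { isSemigroup = record { isMagma = isMagma _∙_ ; assoc = ∙-assoc }
    ; identity    = ∙-identityˡ , ∙-identityʳ
    }
  ; inverse = ∙-inverseˡ , ∙-inverseʳ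
  ; ⁻¹-cong = cong _⁻¹
  }

Γ-group : Group 0ℓ 0ℓ
Γ-group = record { isGroup = Γ-isGroup }

residue : V → Bool
residue (x , y) = odd x xor odd y

residue-+ᵥ : ∀ v w → residue (v +ᵥ w) ≡ residue v xor residue w
residue-+ᵥ (a , b) (c , d) = begin
  odd (a + c) xor odd (b + d)                    ≡⟨ cong₂ _xor_ (odd-+ a c) (odd-+ b d) ⟩
  (odd a xor odd c) xor (odd b xor odd d)        ≡⟨ comm∧assoc⇒middleFour xor-comm xor-assoc (odd a) (odd c) (odd b) (odd d) ⟩
  (odd a xor odd b) xor (odd c xor odd d)        ∎
  where open ≡-Reasoning

residue-rot : ∀ k v → residue (rot k v) ≡ residue v
residue-rot k v = go (toℕ k)
  where
  residue-rot₁ : ∀ v → residue (rot₁ v) ≡ residue v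
  residue-rot₁ (x , y) = trans (cong (_xor odd x) (odd-neg y)) (xor-comm (odd y) (odd x))
  go : ∀ n → residue (turn n v) ≡ residue v
  go zero    = refl
  go (suc n) = trans (residue-rot₁ (turn n v)) (go n)

-- Multiplication and division by ϖ = -1 - i; the division is exact on vectors of residue false.
ϖ*_ : V → V
ϖ* (a , b) = (b - a , - a - b)

_/ϖ : V → V
(x , y) /ϖ = (half (- x - y) , half (x - y))

residue-ϖ* : ∀ w → residue (ϖ* w) ≡ false
residue-ϖ* (a , b) = begin
  odd (b - a) xor odd (- a - b)                  ≡⟨ cong₂ _xor_ (odd-+ b (- a)) (odd-+ (- a) (- b)) ⟩
  (odd b xor odd (- a)) xor (odd (- a) xor odd (- b)) ≡⟨ cong₂ (λ x y → (odd b xor x) xor (x xor y)) (odd-neg a) (odd-neg b) ⟩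
  (odd b xor odd a) xor (odd a xor odd b)        ≡⟨ cong (_xor (odd a xor odd b)) (xor-comm (odd b) (odd a)) ⟩
  (odd a xor odd b) xor (odd a xor odd b)        ≡⟨ xor-same (odd a xor odd b) ⟩
  false                                          ∎
  where open ≡-Reasoning

ϖ*-/ϖ : ∀ w → (ϖ* w) /ϖ ≡ w
ϖ*-/ϖ (a , b) = cong₂ _,_ (trans (cong half (first a b)) (half-double a)) (trans (cong half (second a b)) (half-double b))
  where
  first : ∀ a b → - (b - a) - (- a - b) ≡ a + a
  first = solve-∀
  second : ∀ a b → (b - a) - (- a - b) ≡ b + b
  second = solve-∀

/ϖ-ϖ* : ∀ v → residue v ≡ false → ϖ* (v /ϖ) ≡ v
/ϖ-ϖ* (x , y) even = cong₂ _,_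
  (double-injective _ x (trans (first h₁ h₂) (trans (cong₂ _-_ e₂ e₁) (first′ x y))))
  (double-injective _ y (trans (second h₁ h₂) (trans (cong₂ (λ a b → - a - b) e₁ e₂) (second′ x y))))
  where
  h₁ = half (- x - y)
  h₂ = half (x - y)
  e₁ : h₁ + h₁ ≡ - x - y
  e₁ = half-even (- x - y) (trans (odd-+ (- x) (- y)) (trans (cong₂ _xor_ (odd-neg x) (odd-neg y)) even))
  e₂ : h₂ + h₂ ≡ x - y
  e₂ = half-even (x - y) (trans (odd-+ x (- y)) (trans (cong (odd x xor_) (odd-neg y)) even))
  first : ∀ h₁ h₂ → (h₂ - h₁) + (h₂ - h₁) ≡ (h₂ + h₂) - (h₁ + h₁)
  first = solve-∀
  first′ : ∀ x y → (x - y) - (- x - y) ≡ x + x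
  first′ = solve-∀
  second : ∀ h₁ h₂ → (- h₁ - h₂) + (- h₁ - h₂) ≡ - (h₁ + h₁) - (h₂ + h₂)
  second = solve-∀
  second′ : ∀ x y → - (- x - y) - (x - y) ≡ y + y
  second′ = solve-∀

ϖ*-+ᵥ : ∀ v w → ϖ* (v +ᵥ w) ≡ ϖ* v +ᵥ ϖ* w
ϖ*-+ᵥ (a , b) (c , d) = cong₂ _,_ (first a b c d) (second a b c d)
  where
  first : ∀ a b c d → (b + d) - (a + c) ≡ (b - a) + (d - c)
  first = solve-∀
  second : ∀ a b c d → - (a + c) - (b + d) ≡ (- a - b) + (- c - d)
  second = solve-∀

ϖ*-neg : ∀ v → ϖ* (-ᵥ v) ≡ -ᵥ ϖ* v
ϖ*-neg (a , b) = cong₂ _,_ (first a b) (second a b)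
  where
  first : ∀ a b → - b - - a ≡ - (b - a)
  first = solve-∀
  second : ∀ a b → - - a - - b ≡ - (- a - b)
  second = solve-∀

ϖ*-rot : ∀ k v → ϖ* (rot k v) ≡ rot k (ϖ* v)
ϖ*-rot = rot-commute ϖ*_ ϖ*-rot₁
  where
  ϖ*-rot₁ : ∀ v → ϖ* (rot₁ v) ≡ rot₁ (ϖ* v)
  ϖ*-rot₁ (a , b) = cong₂ _,_ (first a b) (second a b)
    where
    first : ∀ a b → a - - b ≡ - (- a - b)
    first = solve-∀
    second : ∀ a b → - - b - a ≡ b - a
    second = solve-∀

/ϖ-+ᵥ : ∀ v w → residue v ≡ false → residue w ≡ false → (v +ᵥ w) /ϖ ≡ v /ϖ +ᵥ w /ϖ
/ϖ-+ᵥ v w v-even w-even = begin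
  (v +ᵥ w) /ϖ                       ≡⟨ cong₂ (λ x y → (x +ᵥ y) /ϖ) (/ϖ-ϖ* v v-even) (/ϖ-ϖ* w w-even) ⟨
  (ϖ* (v /ϖ) +ᵥ ϖ* (w /ϖ)) /ϖ       ≡⟨ cong _/ϖ (ϖ*-+ᵥ (v /ϖ) (w /ϖ)) ⟨
  (ϖ* (v /ϖ +ᵥ w /ϖ)) /ϖ            ≡⟨ ϖ*-/ϖ (v /ϖ +ᵥ w /ϖ) ⟩
  v /ϖ +ᵥ w /ϖ                      ∎
  where open ≡-Reasoning

/ϖ-rot : ∀ k v → residue v ≡ false → (rot k v) /ϖ ≡ rot k (v /ϖ)
/ϖ-rot k v v-even = begin
  (rot k v) /ϖ                ≡⟨ cong (λ x → (rot k x) /ϖ) (/ϖ-ϖ* v v-even) ⟨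
  (rot k (ϖ* (v /ϖ))) /ϖ      ≡⟨ cong _/ϖ (ϖ*-rot k (v /ϖ)) ⟨
  (ϖ* (rot k (v /ϖ))) /ϖ      ≡⟨ ϖ*-/ϖ (rot k (v /ϖ)) ⟩
  rot k (v /ϖ)                ∎
  where open ≡-Reasoning

record IsSubgroup (P : Γ → Set) : Set where
  field
    ε-closed  : P ε
    ∙-closed  : ∀ {a b} → P a → P b → P (a ∙ b)
    ⁻¹-closed : ∀ {a} → P a → P (a ⁻¹)

∩-isSubgroup : ∀ {P Q} → IsSubgroup P → IsSubgroup Q → IsSubgroup (λ c → P c × Q c)
∩-isSubgroup P-sub Q-sub = record
  { ε-closed  = P.ε-closed , Q.ε-closed
  ; ∙-closed  = λ (pa , qa) (pb , qb) → P.∙-closed pa pb , Q.∙-closed qa qb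
  ; ⁻¹-closed = λ (pa , qa) → P.⁻¹-closed pa , Q.⁻¹-closed qa
  }
  where
  module P = IsSubgroup P-sub
  module Q = IsSubgroup Q-sub

module HomomorphismToAbelian
  (A : AbelianGroup 0ℓ 0ℓ)
  (χ : Γ → AbelianGroup.Carrier A)
  (χ-homo : ∀ a b → AbelianGroup._≈_ A (χ (a ∙ b)) (AbelianGroup._∙_ A (χ a) (χ b)))
  where

  open AbelianGroup A
    using (setoid; ∙-cong; ∙-congʳ; assoc; identityˡ; inverseˡ; ⁻¹-cong; group)
    renaming (_∙_ to _+ᴬ_; _≈_ to _≈ᴬ_; ε to 0ᴬ; _⁻¹ to -ᴬ_)
  open import Algebra.Properties.AbelianGroup A using (xyx⁻¹≈y; ⁻¹-∙-comm)
  open import Algebra.Properties.Group group using (identityˡ-unique; inverseʳ-unique; ε⁻¹≈ε)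
  open import Relation.Binary.Reasoning.Setoid setoid

  χ-ε : χ ε ≈ᴬ 0ᴬ
  χ-ε = identityˡ-unique (χ ε) (χ ε) (begin
    χ ε +ᴬ χ ε  ≈⟨ χ-homo ε ε ⟨
    χ ε         ∎)

  χ-⁻¹ : ∀ a → χ (a ⁻¹) ≈ᴬ -ᴬ χ a
  χ-⁻¹ a = inverseʳ-unique (χ a) (χ (a ⁻¹)) (begin
    χ a +ᴬ χ (a ⁻¹)  ≈⟨ χ-homo a (a ⁻¹) ⟨
    χ (a ∙ a ⁻¹)     ≡⟨ cong χ (∙-inverseʳ a) ⟩
    χ ε              ≈⟨ χ-ε ⟩
    0ᴬ               ∎)

  Kernel : Γ → Set
  Kernel c = χ c ≈ᴬ 0ᴬ

  kernel-isSubgroup : IsSubgroup Kernel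
  kernel-isSubgroup = record
    { ε-closed  = χ-ε
    ; ∙-closed  = λ {a} {b} χa≈0 χb≈0 → begin
        χ (a ∙ b)      ≈⟨ χ-homo a b ⟩
        χ a +ᴬ χ b     ≈⟨ ∙-cong χa≈0 χb≈0 ⟩
        0ᴬ +ᴬ 0ᴬ       ≈⟨ identityˡ 0ᴬ ⟩
        0ᴬ             ∎
    ; ⁻¹-closed = λ {a} χa≈0 → begin
        χ (a ⁻¹)       ≈⟨ χ-⁻¹ a ⟩
        -ᴬ χ a         ≈⟨ ⁻¹-cong χa≈0 ⟩
        -ᴬ 0ᴬ          ≈⟨ ε⁻¹≈ε ⟩
        0ᴬ             ∎
    }

  kernel-conj : ∀ c {a} → Kernel a → Kernel (c ∙ a ∙ c ⁻¹)
  kernel-conj c {a} χa = begin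
    χ (c ∙ a ∙ c ⁻¹)          ≈⟨ χ-homo (c ∙ a) (c ⁻¹) ⟩
    χ (c ∙ a) +ᴬ χ (c ⁻¹)     ≈⟨ ∙-cong (χ-homo c a) (χ-⁻¹ c) ⟩
    χ c +ᴬ χ a +ᴬ -ᴬ χ c      ≈⟨ xyx⁻¹≈y (χ c) (χ a) ⟩
    χ a                       ≈⟨ χa ⟩
    0ᴬ                        ∎

  kernel-commutator : ∀ c d → Kernel (c ⁻¹ ∙ d ⁻¹ ∙ c ∙ d)
  kernel-commutator c d = begin
    χ (c ⁻¹ ∙ d ⁻¹ ∙ c ∙ d)                    ≈⟨ χ-homo (c ⁻¹ ∙ d ⁻¹ ∙ c) d ⟩
    χ (c ⁻¹ ∙ d ⁻¹ ∙ c) +ᴬ χ d                 ≈⟨ ∙-congʳ (χ-homo (c ⁻¹ ∙ d ⁻¹) c) ⟩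
    χ (c ⁻¹ ∙ d ⁻¹) +ᴬ χ c +ᴬ χ d              ≈⟨ ∙-congʳ (∙-congʳ (χ-homo (c ⁻¹) (d ⁻¹))) ⟩
    χ (c ⁻¹) +ᴬ χ (d ⁻¹) +ᴬ χ c +ᴬ χ d         ≈⟨ ∙-congʳ (∙-congʳ (∙-cong (χ-⁻¹ c) (χ-⁻¹ d))) ⟩
    -ᴬ χ c +ᴬ -ᴬ χ d +ᴬ χ c +ᴬ χ d             ≈⟨ ∙-congʳ (∙-congʳ (⁻¹-∙-comm (χ c) (χ d))) ⟩
    -ᴬ (χ c +ᴬ χ d) +ᴬ χ c +ᴬ χ d              ≈⟨ assoc _ _ _ ⟩
    -ᴬ (χ c +ᴬ χ d) +ᴬ (χ c +ᴬ χ d)            ≈⟨ inverseˡ _ ⟩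
    0ᴬ                                         ∎

xor-abelianGroup : AbelianGroup 0ℓ 0ℓ
xor-abelianGroup = CommutativeRing.+-abelianGroup xor-∧-commutativeRing

T : V → Γ
T v = (q0 , v)

residueΓ : Γ → Bool
residueΓ (k , v) = residue v

residueΓ-homo : ∀ a b → residueΓ (a ∙ b) ≡ residueΓ a xor residueΓ b
residueΓ-homo (k , v) (l , w) = trans (residue-+ᵥ (rot l v) w) (cong (_xor residue w) (residue-rot l v))

-- A crossed homomorphism with residue (e₄ k) ≡ true exactly for odd k.
e₄ : Quarter → V
e₄ q0 = (0ℤ , 0ℤ)
e₄ q1 = (0ℤ , 1ℤ)
e₄ q2 = (-[1+ 0 ] , 1ℤ)
e₄ q3 = (-[1+ 0 ] , 0ℤ)

e₄-cocycle : ∀ k l → e₄ (k ⊕ l) ≡ rot l (e₄ k) +ᵥ e₄ l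
e₄-cocycle q0 q0 = refl
e₄-cocycle q0 q1 = refl
e₄-cocycle q0 q2 = refl
e₄-cocycle q0 q3 = refl
e₄-cocycle q1 q0 = refl
e₄-cocycle q1 q1 = refl
e₄-cocycle q1 q2 = refl
e₄-cocycle q1 q3 = refl
e₄-cocycle q2 q0 = refl
e₄-cocycle q2 q1 = refl
e₄-cocycle q2 q2 = refl
e₄-cocycle q2 q3 = refl
e₄-cocycle q3 q0 = refl
e₄-cocycle q3 q1 = refl
e₄-cocycle q3 q2 = refl
e₄-cocycle q3 q3 = refl

twist : Γ → Γ
twist (k , v) = (k , e₄ k +ᵥ v)

twist-homo : ∀ a b → twist (a ∙ b) ≡ twist a ∙ twist b
twist-homo (k , v) (l , w) = cong (k ⊕ l ,_) (begin
  e₄ (k ⊕ l) +ᵥ (rot l v +ᵥ w)                ≡⟨ cong (_+ᵥ (rot l v +ᵥ w)) (e₄-cocycle k l) ⟩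
  (rot l (e₄ k) +ᵥ e₄ l) +ᵥ (rot l v +ᵥ w)    ≡⟨ +ᵥ-interchange (rot l (e₄ k)) (e₄ l) (rot l v) w ⟩
  (rot l (e₄ k) +ᵥ rot l v) +ᵥ (e₄ l +ᵥ w)    ≡⟨ cong (_+ᵥ (e₄ l +ᵥ w)) (rot-+ᵥ l (e₄ k) v) ⟨
  rot l (e₄ k +ᵥ v) +ᵥ (e₄ l +ᵥ w)            ∎)
  where open ≡-Reasoning

τ : Γ → Bool
τ c = residueΓ (twist c)

τ-homo : ∀ a b → τ (a ∙ b) ≡ τ a xor τ b
τ-homo a b = trans (cong residueΓ (twist-homo a b)) (residueΓ-homo (twist a) (twist b))

halfTurn : Bool → Quarter
halfTurn false = q0
halfTurn true  = q2

χ₁ : Γ → Quarter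
χ₁ (k , v) = k ⊕ halfTurn (residue v)

χ₁-homo : ∀ a b → χ₁ (a ∙ b) ≡ χ₁ a ⊕ χ₁ b
χ₁-homo (k , v) (l , w) = begin
  (k ⊕ l) ⊕ halfTurn (residue (rot l v +ᵥ w))
    ≡⟨ cong (λ r → (k ⊕ l) ⊕ halfTurn r) (residueΓ-homo (k , v) (l , w)) ⟩
  (k ⊕ l) ⊕ halfTurn (residue v xor residue w)           ≡⟨ cong ((k ⊕ l) ⊕_) (halfTurn-xor (residue v) (residue w)) ⟩
  (k ⊕ l) ⊕ (halfTurn (residue v) ⊕ halfTurn (residue w)) ≡⟨ comm∧assoc⇒middleFour ⊕-comm ⊕-assoc k l _ _ ⟩
  (k ⊕ halfTurn (residue v)) ⊕ (l ⊕ halfTurn (residue w)) ∎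
  where
  open ≡-Reasoning
  halfTurn-xor : ∀ x y → halfTurn (x xor y) ≡ halfTurn x ⊕ halfTurn y
  halfTurn-xor false y     = sym (⊕-identityˡ (halfTurn y))
  halfTurn-xor true  false = refl
  halfTurn-xor true  true  = refl

rotation-homo : ∀ a b → proj₁ (a ∙ b) ≡ proj₁ a ⊕ proj₁ b
rotation-homo _ _ = refl

module Rotation = HomomorphismToAbelian ⊕-abelianGroup proj₁ rotation-homo
module Residue  = HomomorphismToAbelian xor-abelianGroup residueΓ residueΓ-homo
module Swap     = HomomorphismToAbelian xor-abelianGroup τ τ-homo
module Chi₁     = HomomorphismToAbelian ⊕-abelianGroup χ₁ χ₁-homo

-- The self-similar action of Γ

contract : Γ → Γ
contract (k , w) = (k , w /ϖ)

contract-homo : ∀ a b → residueΓ a ≡ false → residueΓ b ≡ false → contract (a ∙ b) ≡ contract a ∙ contract b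
contract-homo (k , v) (l , w) v-even w-even = cong (k ⊕ l ,_) (begin
  (rot l v +ᵥ w) /ϖ         ≡⟨ /ϖ-+ᵥ (rot l v) w (trans (residue-rot l v) v-even) w-even ⟩
  (rot l v) /ϖ +ᵥ w /ϖ      ≡⟨ cong (_+ᵥ w /ϖ) (/ϖ-rot l v v-even) ⟩
  rot l (v /ϖ) +ᵥ w /ϖ      ∎)
  where open ≡-Reasoning

ψ : Γ → Γ
ψ c = contract (twist c)

ψ-homo : ∀ a b → τ a ≡ false → τ b ≡ false → ψ (a ∙ b) ≡ ψ a ∙ ψ b
ψ-homo a b τa τb = trans (cong contract (twist-homo a b)) (contract-homo (twist a) (twist b) τa τb)

α₁ α₂ α₃ : Γ
α₁ = (q2 , (0ℤ , -[1+ 0 ]))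
α₂ = (q1 , 0ᵥ)
α₃ = (q1 , (0ℤ , -[1+ 0 ]))

t : Letter → Γ
t zero       = ε
t (suc zero) = α₁

-- The argument of ψ lies in Kernel τ (τ-t∙c∙t≡false), where ψ is a homomorphism.
secΓ : Letter → Γ → Γ
secΓ i c = ψ (t i ∙ c ∙ t (act (τ c) i))

Φ : Γ → Ω
Φ c []      = τ c
Φ c (i ∷ w) = Φ (secΓ i c) w

act-xor : ∀ x y i → act (x xor y) i ≡ act y (act x i)
act-xor false y    i          = refl
act-xor true  false i         = refl
act-xor true  true zero       = refl
act-xor true  true (suc zero) = refl

act-involutive : ∀ x i → act x (act x i) ≡ i
act-involutive false i          = refl
act-involutive true  zero       = refl
act-involutive true  (suc zero) = refl

τ-t∙c∙t≡false : ∀ i c → τ (t i ∙ c ∙ t (act (τ c) i)) ≡ false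
τ-t∙c∙t≡false i c = begin
  τ (t i ∙ c ∙ t j)               ≡⟨ τ-homo (t i ∙ c) (t j) ⟩
  τ (t i ∙ c) xor τ (t j)         ≡⟨ cong (_xor τ (t j)) (τ-homo (t i) c) ⟩
  (τ (t i) xor τ c) xor τ (t j)   ≡⟨ balance i (τ c) ⟩
  false                           ∎
  where
  open ≡-Reasoning
  j = act (τ c) i
  balance : ∀ i x → (τ (t i) xor x) xor τ (t (act x i)) ≡ false
  balance zero       false = refl
  balance zero       true  = refl
  balance (suc zero) false = refl
  balance (suc zero) true  = refl

secΓ-homo : ∀ i a b → secΓ i (a ∙ b) ≡ secΓ i a ∙ secΓ (act (τ a) i) b
secΓ-homo i a b = begin
  ψ (t i ∙ (a ∙ b) ∙ t (act (τ (a ∙ b)) i))     ≡⟨ cong (λ x → ψ (t i ∙ (a ∙ b) ∙ t x)) act-ab ⟩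
  ψ (t i ∙ (a ∙ b) ∙ t l)                       ≡⟨ cong ψ (regroup (t i) a (t j) b (t l) (t-involutive j)) ⟩
  ψ ((t i ∙ a ∙ t j) ∙ (t j ∙ b ∙ t l))
    ≡⟨ ψ-homo (t i ∙ a ∙ t j) (t j ∙ b ∙ t l) (τ-t∙c∙t≡false i a) (τ-t∙c∙t≡false j b) ⟩
  ψ (t i ∙ a ∙ t j) ∙ ψ (t j ∙ b ∙ t l)         ∎
  where
  open ≡-Reasoning
  j = act (τ a) i
  l = act (τ b) j
  act-ab : act (τ (a ∙ b)) i ≡ l
  act-ab = trans (cong (λ x → act x i) (τ-homo a b)) (act-xor (τ a) (τ b) i)
  t-involutive : ∀ i → t i ∙ t i ≡ ε
  t-involutive zero       = refl
  t-involutive (suc zero) = refl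
  regroup : ∀ x a y b z → y ∙ y ≡ ε → x ∙ (a ∙ b) ∙ z ≡ (x ∙ a ∙ y) ∙ (y ∙ b ∙ z)
  regroup x a y b z yy = begin
    x ∙ (a ∙ b) ∙ z             ≡⟨ cong (_∙ z) (∙-assoc x a b) ⟨
    x ∙ a ∙ b ∙ z               ≡⟨ cong (λ u → x ∙ a ∙ u ∙ z) (trans (cong (_∙ b) yy) (∙-identityˡ b)) ⟨
    x ∙ a ∙ (y ∙ y ∙ b) ∙ z     ≡⟨ cong (λ u → x ∙ a ∙ u ∙ z) (∙-assoc y y b) ⟩
    x ∙ a ∙ (y ∙ (y ∙ b)) ∙ z   ≡⟨ cong (_∙ z) (∙-assoc (x ∙ a) y (y ∙ b)) ⟨
    x ∙ a ∙ y ∙ (y ∙ b) ∙ z     ≡⟨ ∙-assoc (x ∙ a ∙ y) (y ∙ b) z ⟩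
    (x ∙ a ∙ y) ∙ (y ∙ b ∙ z)   ∎

secΓ-ε : ∀ i → secΓ i ε ≡ ε
secΓ-ε zero       = refl
secΓ-ε (suc zero) = refl

secΓ-⁻¹ : ∀ i a → secΓ i (a ⁻¹) ≡ secΓ (act (τ a) i) a ⁻¹
secΓ-⁻¹ i a = inverseʳ-unique (secΓ j a) (secΓ i (a ⁻¹)) (begin
  secΓ j a ∙ secΓ i (a ⁻¹)                   ≡⟨ cong (λ x → secΓ j a ∙ secΓ x (a ⁻¹)) (act-involutive (τ a) i) ⟨
  secΓ j a ∙ secΓ (act (τ a) j) (a ⁻¹)       ≡⟨ secΓ-homo j a (a ⁻¹) ⟨
  secΓ j (a ∙ a ⁻¹)                          ≡⟨ cong (secΓ j) (∙-inverseʳ a) ⟩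
  secΓ j ε                                   ≡⟨ secΓ-ε j ⟩
  ε                                          ∎)
  where
  open ≡-Reasoning
  open import Algebra.Properties.Group Γ-group using (inverseʳ-unique)
  j = act (τ a) i

Φ-homo : ∀ a b → Φ (a ∙ b) ≈ (Φ a · Φ b)
Φ-homo a b []      = τ-homo a b
Φ-homo a b (i ∷ w) = trans (cong (λ c → Φ c w) (secΓ-homo i a b)) (Φ-homo (secΓ i a) (secΓ (act (τ a) i) b) w)

Φ-⁻¹ : ∀ a → Φ (a ⁻¹) ≈ inv (Φ a)
Φ-⁻¹ a []      = Swap.χ-⁻¹ a
Φ-⁻¹ a (i ∷ w) = trans (cong (λ c → Φ c w) (secΓ-⁻¹ i a)) (Φ-⁻¹ (secΓ (act (τ a) i) a) w)

Φ-ε : Φ ε ≈ e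
Φ-ε []             = refl
Φ-ε (zero ∷ w)     = Φ-ε w
Φ-ε (suc zero ∷ w) = Φ-ε w

Φ-α₁ : Φ α₁ ≈ a1
Φ-α₁ []             = refl
Φ-α₁ (zero ∷ w)     = Φ-ε w
Φ-α₁ (suc zero ∷ w) = Φ-ε w

Φ-α₂ : Φ α₂ ≈ a2
Φ-α₂⁻¹ : Φ (α₂ ⁻¹) ≈ a2i
Φ-α₃ : Φ α₃ ≈ a3
Φ-α₃⁻¹ : Φ (α₃ ⁻¹) ≈ a3i
Φ-α₂ []               = refl
Φ-α₂ (zero ∷ w)       = Φ-α₃⁻¹ w
Φ-α₂ (suc zero ∷ w)   = Φ-α₂⁻¹ w
Φ-α₂⁻¹ []             = refl
Φ-α₂⁻¹ (zero ∷ w)     = Φ-α₂ w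
Φ-α₂⁻¹ (suc zero ∷ w) = Φ-α₃ w
Φ-α₃ []               = refl
Φ-α₃ (zero ∷ w)       = Φ-α₂ w
Φ-α₃ (suc zero ∷ w)   = Φ-α₃ w
Φ-α₃⁻¹ []             = refl
Φ-α₃⁻¹ (zero ∷ w)     = Φ-α₂⁻¹ w
Φ-α₃⁻¹ (suc zero ∷ w) = Φ-α₃⁻¹ w

-- Approximation in the profinite topology

≈-refl : ∀ {g} → g ≈ g
≈-refl _ = refl

≈-sym : ∀ {g h} → g ≈ h → h ≈ g
≈-sym p w = sym (p w)

≈-trans : ∀ {g h k} → g ≈ h → h ≈ k → g ≈ k
≈-trans p q w = trans (p w) (q w)

≈[]-refl : ∀ {n g} → g ≈[ n ] g
≈[]-refl _ _ = refl

≈[]-sym : ∀ {n g h} → g ≈[ n ] h → h ≈[ n ] g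
≈[]-sym p w l = sym (p w l)

≈[]-trans : ∀ {n g h k} → g ≈[ n ] h → h ≈[ n ] k → g ≈[ n ] k
≈[]-trans p q w l = trans (p w l) (q w l)

≈⇒≈[] : ∀ {n g h} → g ≈ h → g ≈[ n ] h
≈⇒≈[] p w _ = p w

≈[]⇒≈ : ∀ {g h} → (∀ n → g ≈[ n ] h) → g ≈ h
≈[]⇒≈ p w = p (suc (length w)) w ℕ.≤-refl

sec-cong : ∀ {n g h} → g ≈[ suc n ] h → ∀ i → sec g i ≈[ n ] sec h i
sec-cong p i w l = p (i ∷ w) (s≤s l)

·-cong : ∀ n {g g′ h h′} → g ≈[ n ] g′ → h ≈[ n ] h′ → (g · h) ≈[ n ] (g′ · h′)
·-cong n       p q []      l       = cong₂ _xor_ (p [] l) (q [] l)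
·-cong (suc n) {g} {g′} {h} {h′} p q (i ∷ w) (s≤s l) =
  trans (·-cong n (sec-cong p i) (sec-cong q (act (g []) i)) w l)
        (cong (λ b → (sec g′ i · sec h′ (act b i)) w) (p [] (s≤s z≤n)))

inv-cong : ∀ n {g g′} → g ≈[ n ] g′ → inv g ≈[ n ] inv g′
inv-cong n       p []      l       = p [] l
inv-cong (suc n) {g} {g′} p (i ∷ w) (s≤s l) =
  trans (inv-cong n (sec-cong p (act (g []) i)) w l)
        (cong (λ b → inv (sec g′ (act b i)) w) (p [] (s≤s z≤n)))

·-cong≈ : ∀ {g g′ h h′} → g ≈ g′ → h ≈ h′ → (g · h) ≈ (g′ · h′)
·-cong≈ p q = ≈[]⇒≈ λ n → ·-cong n (≈⇒≈[] p) (≈⇒≈[] q)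

inv-cong≈ : ∀ {g g′} → g ≈ g′ → inv g ≈ inv g′
inv-cong≈ p = ≈[]⇒≈ λ n → inv-cong n (≈⇒≈[] p)

pair-cong : ∀ {n x x′ y y′} → x ≈[ n ] x′ → y ≈[ n ] y′ → pair x y ≈[ suc n ] pair x′ y′
pair-cong p q []             _       = refl
pair-cong p q (zero ∷ w)     (s≤s l) = p w l
pair-cong p q (suc zero ∷ w) (s≤s l) = q w l

Φ-conj : ∀ c α → Φ (c ∙ α ∙ c ⁻¹) ≈ (Φ c · Φ α · inv (Φ c))
Φ-conj c α w = trans (Φ-homo (c ∙ α) (c ⁻¹) w) (·-cong≈ (Φ-homo c α) (Φ-⁻¹ c) w)

Φ-commutator : ∀ c d → Φ (c ⁻¹ ∙ d ⁻¹ ∙ c ∙ d) ≈ (inv (Φ c) · inv (Φ d) · Φ c · Φ d)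
Φ-commutator c d w = begin
  Φ (c ⁻¹ ∙ d ⁻¹ ∙ c ∙ d) w                ≡⟨ Φ-homo (c ⁻¹ ∙ d ⁻¹ ∙ c) d w ⟩
  (Φ (c ⁻¹ ∙ d ⁻¹ ∙ c) · Φ d) w            ≡⟨ ·-cong≈ (Φ-homo (c ⁻¹ ∙ d ⁻¹) c) ≈-refl w ⟩
  (Φ (c ⁻¹ ∙ d ⁻¹) · Φ c · Φ d) w          ≡⟨ ·-cong≈ (·-cong≈ (Φ-homo (c ⁻¹) (d ⁻¹)) ≈-refl) ≈-refl w ⟩
  (Φ (c ⁻¹) · Φ (d ⁻¹) · Φ c · Φ d) w      ≡⟨ ·-cong≈ (·-cong≈ (·-cong≈ (Φ-⁻¹ c) (Φ-⁻¹ d)) ≈-refl) ≈-refl w ⟩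
  (inv (Φ c) · inv (Φ d) · Φ c · Φ d) w    ∎
  where open ≡-Reasoning

Approx : (Γ → Set) → ℕ → Ω → Set
Approx P n g = Σ Γ λ c → P c × g ≈[ n ] Φ c

cl-Φ : (Γ → Set) → Ω → Set
cl-Φ P g = ∀ n → Approx P n g

approx-zero : ∀ {P g} → P ε → Approx P 0 g
approx-zero ε∈P = ε , ε∈P , λ _ ()

module _ {S : Subset} {P : Γ → Set} (P-sub : IsSubgroup P) (S⊆ : ∀ {g} → S g → cl-Φ P g) where
  open IsSubgroup P-sub

  Gen⊆cl-Φ : ∀ {g} → Gen S g → cl-Φ P g
  Gen⊆cl-Φ (gen s)   n = S⊆ s n
  Gen⊆cl-Φ one       n = ε , ε-closed , ≈⇒≈[] (≈-sym Φ-ε)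
  Gen⊆cl-Φ (mul x y) n with Gen⊆cl-Φ x n | Gen⊆cl-Φ y n
  ... | a , pa , x≈a | b , pb , y≈b =
    a ∙ b , ∙-closed pa pb , ≈[]-trans (·-cong n x≈a y≈b) (≈⇒≈[] (≈-sym (Φ-homo a b)))
  Gen⊆cl-Φ (neg x)   n with Gen⊆cl-Φ x n
  ... | a , pa , x≈a = a ⁻¹ , ⁻¹-closed pa , ≈[]-trans (inv-cong n x≈a) (≈⇒≈[] (≈-sym (Φ-⁻¹ a)))

  cl-Gen⊆cl-Φ : ∀ {g} → cl (Gen S) g → cl-Φ P g
  cl-Gen⊆cl-Φ g∈cl n with g∈cl n
  ... | h , h∈Gen , g≈h with Gen⊆cl-Φ h∈Gen n
  ... | c , pc , h≈c = c , pc , ≈[]-trans g≈h h≈c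

Everything : Γ → Set
Everything _ = ⊤

everything-isSubgroup : IsSubgroup Everything
everything-isSubgroup = record { ε-closed = tt ; ∙-closed = λ _ _ → tt ; ⁻¹-closed = λ _ → tt }

G⊆cl-Φ : ∀ {g} → G g → cl-Φ Everything g
G⊆cl-Φ = cl-Gen⊆cl-Φ everything-isSubgroup generator
  where
  generator : ∀ {g} → Gens g → cl-Φ Everything g
  generator (inj₁ refl)        n = α₁ , tt , ≈⇒≈[] (≈-sym Φ-α₁)
  generator (inj₂ (inj₁ refl)) n = α₂ , tt , ≈⇒≈[] (≈-sym Φ-α₂)
  generator (inj₂ (inj₂ refl)) n = α₃ , tt , ≈⇒≈[] (≈-sym Φ-α₃)

Conj⊆cl-Φ : ∀ {a α P} → a ≈ Φ α → (∀ c → P (c ∙ α ∙ c ⁻¹)) → ∀ {g} → Conj a g → cl-Φ P g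
Conj⊆cl-Φ {α = α} a≈α conj∈P (h , h∈G , refl) n =
  let (c , _ , h≈c) = G⊆cl-Φ h∈G n
  in c ∙ α ∙ c ⁻¹ , conj∈P c ,
     ≈[]-trans (·-cong n (·-cong n h≈c (≈⇒≈[] a≈α)) (inv-cong n h≈c)) (≈⇒≈[] (≈-sym (Φ-conj c α)))

Comm⊆cl-Φ : ∀ {P} → (∀ c d → P (c ⁻¹ ∙ d ⁻¹ ∙ c ∙ d)) → ∀ {g} → Comm g → cl-Φ P g
Comm⊆cl-Φ comm∈P (h , k , h∈G , k∈G , refl) n =
  let (c , _ , h≈c) = G⊆cl-Φ h∈G n
      (d , _ , k≈d) = G⊆cl-Φ k∈G n
  in c ⁻¹ ∙ d ⁻¹ ∙ c ∙ d , comm∈P c d ,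
     ≈[]-trans (·-cong n (·-cong n (·-cong n (inv-cong n h≈c) (inv-cong n k≈d)) h≈c) k≈d)
               (≈⇒≈[] (≈-sym (Φ-commutator c d)))

Realizes : Subset → Γ → Set
Realizes S c = Σ Ω λ h → Gen S h × h ≈ Φ c

realizes-isSubgroup : ∀ {S} → IsSubgroup (Realizes S)
realizes-isSubgroup = record
  { ε-closed  = e , one , ≈-sym Φ-ε
  ; ∙-closed  = λ {a} {b} (g , g∈S , g≈a) (h , h∈S , h≈b) →
      g · h , mul g∈S h∈S , ≈-trans (·-cong≈ g≈a h≈b) (≈-sym (Φ-homo a b))
  ; ⁻¹-closed = λ {a} (g , g∈S , g≈a) →
      inv g , neg g∈S , ≈-trans (inv-cong≈ g≈a) (≈-sym (Φ-⁻¹ a))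
  }

approx⇒Gen : ∀ {S P n g} → (∀ {c} → P c → Realizes S c) → Approx P n g → Σ Ω λ h → Gen S h × g ≈[ n ] h
approx⇒Gen P⊆ (c , pc , g≈c) =
  let (h , h∈Gen , h≈c) = P⊆ pc in h , h∈Gen , ≈[]-trans g≈c (≈⇒≈[] (≈-sym h≈c))

cl-Φ⊆cl-Gen : ∀ {S P} → (∀ {c} → P c → Realizes S c) → ∀ {g} → cl-Φ P g → cl (Gen S) g
cl-Φ⊆cl-Gen P⊆ g∈cl n = approx⇒Gen P⊆ (g∈cl n)

approx⇒Proj : ∀ {S P n g} → (∀ {c} → P c → Realizes S c) → Approx P n g → Proj n (cl (Gen S)) g
approx⇒Proj P⊆ (c , pc , g≈c) = Φ c , cl-Φ⊆cl-Gen P⊆ (λ n → c , pc , ≈[]-refl) , g≈c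

Gen⊆cl : ∀ {S g} → Gen S g → cl (Gen S) g
Gen⊆cl g∈Gen n = _ , g∈Gen , ≈[]-refl

ε-realizes : Realizes Gens ε
ε-realizes = e , one , ≈-sym Φ-ε

α₁-realizes : Realizes Gens α₁
α₁-realizes = a1 , gen (inj₁ refl) , ≈-sym Φ-α₁

α₂-realizes : Realizes Gens α₂
α₂-realizes = a2 , gen (inj₂ (inj₁ refl)) , ≈-sym Φ-α₂

α₃-realizes : Realizes Gens α₃
α₃-realizes = a3 , gen (inj₂ (inj₂ refl)) , ≈-sym Φ-α₃

conj-realizes : ∀ {a α c} → Realizes Gens c → a ≈ Φ α → Realizes (Conj a) (c ∙ α ∙ c ⁻¹)
conj-realizes {a} {α} {c} (h , h∈G , h≈c) a≈α = h · a · inv h , gen (h , Gen⊆cl h∈G , refl) ,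
  ≈-trans (·-cong≈ (·-cong≈ h≈c a≈α) (inv-cong≈ h≈c)) (≈-sym (Φ-conj c α))

commutator-realizes : ∀ {c d} → Realizes Gens c → Realizes Gens d → Realizes Comm (c ⁻¹ ∙ d ⁻¹ ∙ c ∙ d)
commutator-realizes {c} {d} (h , h∈G , h≈c) (k , k∈G , k≈d) =
  inv h · inv k · h · k , gen (h , k , Gen⊆cl h∈G , Gen⊆cl k∈G , refl) ,
  ≈-trans (·-cong≈ (·-cong≈ (·-cong≈ (inv-cong≈ h≈c) (inv-cong≈ k≈d)) h≈c) k≈d) (≈-sym (Φ-commutator c d))

ℤ²-generated : ∀ {Q : V → Set} → Q 0ᵥ → (∀ {v w} → Q v → Q w → Q (v +ᵥ w)) → (∀ {v} → Q v → Q (-ᵥ v)) →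
               Q (1ℤ , 0ℤ) → Q (0ℤ , 1ℤ) → ∀ v → Q v
ℤ²-generated {Q} Q-0 Q-+ Q-neg Q-e₁ Q-e₂ (x , y) =
  subst Q (cong₂ _,_ (+-identityʳ x) (+-identityˡ y)) (Q-+ (first x) (second y))
  where
  first⁺ : ∀ n → Q (+ n , 0ℤ)
  first⁺ zero    = Q-0
  first⁺ (suc n) = Q-+ Q-e₁ (first⁺ n)
  first : ∀ x → Q (x , 0ℤ)
  first (+ n)    = first⁺ n
  first -[1+ n ] = Q-neg (first⁺ (suc n))
  second⁺ : ∀ n → Q (0ℤ , + n)
  second⁺ zero    = Q-0
  second⁺ (suc n) = Q-+ Q-e₂ (second⁺ n)
  second : ∀ y → Q (0ℤ , y)
  second (+ n)    = second⁺ n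
  second -[1+ n ] = Q-neg (second⁺ (suc n))

translations-generated : ∀ {P} → IsSubgroup P → P (T (1ℤ , 0ℤ)) → P (T (0ℤ , 1ℤ)) → ∀ v → P (T v)
translations-generated P-sub = ℤ²-generated ε-closed ∙-closed ⁻¹-closed
  where open IsSubgroup P-sub

evenTranslations-generated : ∀ {P} → IsSubgroup P → P (T (ϖ* (1ℤ , 0ℤ))) → P (T (ϖ* (0ℤ , 1ℤ))) →
                             ∀ w → P (T (ϖ* w))
evenTranslations-generated {P} P-sub = ℤ²-generated ε-closed
  (λ {v} {w} pv pw → subst (P ∘ T) (sym (ϖ*-+ᵥ v w)) (∙-closed pv pw))
  (λ {v} pv → subst (P ∘ T) (sym (ϖ*-neg v)) (⁻¹-closed pv))
  where open IsSubgroup P-sub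

Translation : Γ → Set
Translation = Rotation.Kernel

EvenTranslation : Γ → Set
EvenTranslation c = Translation c × Residue.Kernel c

evenTranslation-isSubgroup : IsSubgroup EvenTranslation
evenTranslation-isSubgroup = ∩-isSubgroup Rotation.kernel-isSubgroup Residue.kernel-isSubgroup

evenTranslation-commutator : ∀ c d → EvenTranslation (c ⁻¹ ∙ d ⁻¹ ∙ c ∙ d)
evenTranslation-commutator c d = Rotation.kernel-commutator c d , Residue.kernel-commutator c d

kernels⇒evenTranslation : ∀ c → Chi₁.Kernel c → Swap.Kernel c → EvenTranslation c
kernels⇒evenTranslation (k , v) χ₁≡q0 τ≡false =
  cases k (residue v) χ₁≡q0 (trans (sym (residue-+ᵥ (e₄ k) v)) τ≡false)
  where
  cases : ∀ k r → k ⊕ halfTurn r ≡ q0 → residue (e₄ k) xor r ≡ false → k ≡ q0 × r ≡ false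
  cases q0 false _  _  = refl , refl
  cases q0 true  () _
  cases q1 false () _
  cases q1 true  () _
  cases q2 false () _
  cases q2 true  _  ()
  cases q3 false () _
  cases q3 true  () _

translation-realizes : ∀ {S} → Realizes S (T (1ℤ , 0ℤ)) → Realizes S (T (0ℤ , 1ℤ)) →
                       ∀ {c} → Translation c → Realizes S c
translation-realizes r₁ r₂ {k , v} refl = translations-generated realizes-isSubgroup r₁ r₂ v

evenTranslation-realizes : ∀ {S} → Realizes S (T (ϖ* (1ℤ , 0ℤ))) → Realizes S (T (ϖ* (0ℤ , 1ℤ))) →
                           ∀ {c} → EvenTranslation c → Realizes S c
evenTranslation-realizes {S} r₁ r₂ {k , v} (refl , v-even) =
  subst (Realizes S ∘ T) (/ϖ-ϖ* v v-even) (evenTranslations-generated realizes-isSubgroup r₁ r₂ (v /ϖ))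

τ-translation : ∀ v → τ (T v) ≡ residue v
τ-translation v = cong residue (+ᵥ-identityˡ v)

ψ-translation : ∀ v → ψ (T v) ≡ T (v /ϖ)
ψ-translation v = cong (λ u → T (u /ϖ)) (+ᵥ-identityˡ v)

secΓ₀-translation : ∀ v → residue v ≡ false → secΓ zero (T v) ≡ T (v /ϖ)
secΓ₀-translation v v-even = begin
  ψ (ε ∙ T v ∙ t (act (τ (T v)) zero))
    ≡⟨ cong (λ b → ψ (ε ∙ T v ∙ t (act b zero))) (trans (τ-translation v) v-even) ⟩
  ψ (ε ∙ T v ∙ ε)                       ≡⟨ cong ψ (trans (∙-identityʳ (ε ∙ T v)) (∙-identityˡ (T v))) ⟩
  ψ (T v)                               ≡⟨ ψ-translation v ⟩
  T (v /ϖ)                              ∎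
  where open ≡-Reasoning

secΓ₁-translation : ∀ v → residue v ≡ false → secΓ (suc zero) (T v) ≡ T (v /ϖ) ⁻¹
secΓ₁-translation v v-even = begin
  ψ (α₁ ∙ T v ∙ t (act (τ (T v)) (suc zero)))
    ≡⟨ cong (λ b → ψ (α₁ ∙ T v ∙ t (act b (suc zero)))) (trans (τ-translation v) v-even) ⟩
  ψ (α₁ ∙ T v ∙ α₁)                            ≡⟨ cong ψ (α₁-conj v) ⟩
  ψ (T (rot q2 v))                             ≡⟨ ψ-translation (rot q2 v) ⟩
  T (rot q2 v /ϖ)                              ≡⟨ cong T (/ϖ-rot q2 v v-even) ⟩
  T (rot q2 (v /ϖ))                            ∎
  where
  open ≡-Reasoning
  α₁-conj : ∀ v → α₁ ∙ T v ∙ α₁ ≡ T (rot q2 v)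
  α₁-conj (x , y) = cong T (cong₂ _,_ (first x) (second y))
    where
    first : ∀ x → - (0ℤ + x) + 0ℤ ≡ - x
    first = solve-∀
    second : ∀ y → - (-[1+ 0 ] + y) + -[1+ 0 ] ≡ - y
    second = solve-∀

Φ-evenTranslation : ∀ v → residue v ≡ false → Φ (T v) ≈ pair (Φ (T (v /ϖ))) (inv (Φ (T (v /ϖ))))
Φ-evenTranslation v v-even []             = trans (τ-translation v) v-even
Φ-evenTranslation v v-even (zero ∷ w)     = cong (λ c → Φ c w) (secΓ₀-translation v v-even)
Φ-evenTranslation v v-even (suc zero ∷ w) =
  trans (cong (λ c → Φ c w) (secΓ₁-translation v v-even)) (Φ-⁻¹ (T (v /ϖ)) w)

Φ-ϖ* : ∀ w → Φ (T (ϖ* w)) ≈ pair (Φ (T w)) (inv (Φ (T w)))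
Φ-ϖ* w = subst (λ u → Φ (T (ϖ* w)) ≈ pair (Φ (T u)) (inv (Φ (T u)))) (ϖ*-/ϖ w)
  (Φ-evenTranslation (ϖ* w) (residue-ϖ* w))

sec₀-approx : ∀ {n g} → Approx EvenTranslation (suc n) g → Approx Translation n (sec g zero)
sec₀-approx ((k , v) , (refl , v-even) , g≈c) =
  T (v /ϖ) , refl , sec-cong (≈[]-trans g≈c (≈⇒≈[] (Φ-evenTranslation v v-even))) zero

diagonal-approx : ∀ {n g} → Approx EvenTranslation (suc n) g → g ≈[ suc n ] pair (sec g zero) (inv (sec g zero))
diagonal-approx {n} g≈c@((k , v) , (refl , v-even) , g≈Φc) =
  ≈[]-trans (≈[]-trans g≈Φc (≈⇒≈[] (Φ-evenTranslation v v-even)))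
            (pair-cong (≈[]-sym sec≈) (inv-cong n (≈[]-sym sec≈)))
  where
  sec≈ = proj₂ (proj₂ (sec₀-approx g≈c))

pair-approx : ∀ {n g x} → g ≈[ suc n ] pair x (inv x) → Approx Translation n x → Approx EvenTranslation (suc n) g
pair-approx {n} g≈pair ((k , w) , refl , x≈w) = T (ϖ* w) , (refl , residue-ϖ* w) ,
  ≈[]-trans g≈pair (≈[]-trans (pair-cong x≈w (inv-cong n x≈w)) (≈⇒≈[] (≈-sym (Φ-ϖ* w))))

ϖ-lift : ∀ {n x} → Approx Translation n x → Σ Γ λ c → EvenTranslation c × sec (Φ c) zero ≈[ n ] x
ϖ-lift ((k , w) , refl , x≈w) =
  T (ϖ* w) , (refl , residue-ϖ* w) , ≈[]-trans (λ v _ → Φ-ϖ* w (zero ∷ v)) (≈[]-sym x≈w)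

-- The subgroups H1, H3, U and [[G,G]]

β : Γ
β = α₂ ∙ α₃ ⁻¹

Φ-β : (a2 · inv a3) ≈ Φ β
Φ-β = ≈-sym (≈-trans (Φ-homo α₂ (α₃ ⁻¹)) (·-cong≈ Φ-α₂ (≈-trans (Φ-⁻¹ α₃) (inv-cong≈ Φ-α₃))))

Conj-a1-realizes : ∀ {c} → EvenTranslation c → Realizes (Conj a1) c
Conj-a1-realizes = evenTranslation-realizes
  (∙-closed (conj-realizes α₃-realizes a1≈α₁) (conj-realizes ε-realizes a1≈α₁))
  (∙-closed (conj-realizes α₂-realizes a1≈α₁) (conj-realizes ε-realizes a1≈α₁))
  where
  open IsSubgroup realizes-isSubgroup
  a1≈α₁ = ≈-sym Φ-α₁

Conj-a3-realizes : ∀ {c} → EvenTranslation c → Realizes (Conj a3) c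
Conj-a3-realizes = evenTranslation-realizes
  (∙-closed (conj-realizes ε-realizes a3≈α₃) (⁻¹-closed (conj-realizes α₁-realizes a3≈α₃)))
  (∙-closed (⁻¹-closed (conj-realizes α₁-realizes a3≈α₃)) (conj-realizes ε-realizes a3≈α₃))
  where
  open IsSubgroup realizes-isSubgroup
  a3≈α₃ = ≈-sym Φ-α₃

Comm-realizes : ∀ {c} → EvenTranslation c → Realizes Comm c
Comm-realizes = evenTranslation-realizes
  (commutator-realizes α₂-realizes α₁-realizes)
  (commutator-realizes α₁-realizes α₃-realizes)

Conj-a2a3⁻¹-realizes : ∀ {c} → Translation c → Realizes (Conj (a2 · inv a3)) c
Conj-a2a3⁻¹-realizes = translation-realizes
  (conj-realizes ε-realizes Φ-β)
  (⁻¹-closed (conj-realizes α₂-realizes Φ-β))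
  where open IsSubgroup realizes-isSubgroup

H₁⊆cl-Φ : ∀ {g} → H1 g → cl-Φ Chi₁.Kernel g
H₁⊆cl-Φ = cl-Gen⊆cl-Φ Chi₁.kernel-isSubgroup (Conj⊆cl-Φ (≈-sym Φ-α₁) (λ c → Chi₁.kernel-conj c {α₁} refl))

H₃⊆cl-Φ : ∀ {g} → H3 g → cl-Φ Swap.Kernel g
H₃⊆cl-Φ = cl-Gen⊆cl-Φ Swap.kernel-isSubgroup (Conj⊆cl-Φ (≈-sym Φ-α₃) (λ c → Swap.kernel-conj c {α₃} refl))

U⊆cl-Φ : ∀ {g} → U g → cl-Φ Translation g
U⊆cl-Φ = cl-Gen⊆cl-Φ Rotation.kernel-isSubgroup (Conj⊆cl-Φ Φ-β (λ c → Rotation.kernel-conj c {β} refl))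

DerG⊆cl-Φ : ∀ {g} → DerG g → cl-Φ EvenTranslation g
DerG⊆cl-Φ = cl-Gen⊆cl-Φ evenTranslation-isSubgroup (Comm⊆cl-Φ evenTranslation-commutator)

H₁∩H₃-approx : ∀ n {g h₁ h₃} → H1 h₁ → H3 h₃ → g ≈[ n ] h₁ → g ≈[ n ] h₃ → Approx EvenTranslation n g
H₁∩H₃-approx zero    _     _     _     _     = approx-zero (refl , refl)
H₁∩H₃-approx (suc n) h₁∈H₁ h₃∈H₃ g≈h₁ g≈h₃ =
  let (c₁ , χ₁c₁≡q0 , h₁≈c₁) = H₁⊆cl-Φ h₁∈H₁ (suc n)
      (c₃ , τc₃≡false , h₃≈c₃) = H₃⊆cl-Φ h₃∈H₃ (suc n)
      g≈c₁ = ≈[]-trans g≈h₁ h₁≈c₁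
      -- τ c₁ and τ c₃ are both the root label of g
      τc₁≡false = trans (sym (g≈c₁ [] (s≤s z≤n))) (trans (≈[]-trans g≈h₃ h₃≈c₃ [] (s≤s z≤n)) τc₃≡false)
  in c₁ , kernels⇒evenTranslation c₁ χ₁c₁≡q0 τc₁≡false , g≈c₁

H₁∩H₃⊆cl-Φ : ∀ {g} → (H1 ∩ H3) g → cl-Φ EvenTranslation g
H₁∩H₃⊆cl-Φ (h₁ , h₃) n = H₁∩H₃-approx n h₁ h₃ ≈[]-refl ≈[]-refl

cl-Φ⊆H₁∩H₃ : ∀ {g} → cl-Φ EvenTranslation g → (H1 ∩ H3) g
cl-Φ⊆H₁∩H₃ g∈cl = cl-Φ⊆cl-Gen Conj-a1-realizes g∈cl , cl-Φ⊆cl-Gen Conj-a3-realizes g∈cl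

DerG⊆H₁∩H₃ : ∀ {g} → DerG g → (H1 ∩ H3) g
DerG⊆H₁∩H₃ g∈DerG = cl-Φ⊆H₁∩H₃ (DerG⊆cl-Φ g∈DerG)

H₁∩H₃⊆DerG : ∀ {g} → (H1 ∩ H3) g → DerG g
H₁∩H₃⊆DerG g∈H = cl-Φ⊆cl-Gen Comm-realizes (H₁∩H₃⊆cl-Φ g∈H)

H₁∩H₃⊆DiagU : ∀ {g} → (H1 ∩ H3) g → DiagU g
H₁∩H₃⊆DiagU {g} g∈H = sec g zero ,
  cl-Φ⊆cl-Gen Conj-a2a3⁻¹-realizes (λ n → sec₀-approx (H₁∩H₃⊆cl-Φ g∈H (suc n))) ,
  λ w → diagonal-approx (H₁∩H₃⊆cl-Φ g∈H (suc (length w))) w (s≤s ℕ.≤-refl)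

DiagU⊆H₁∩H₃ : ∀ {g} → DiagU g → (H1 ∩ H3) g
DiagU⊆H₁∩H₃ (x , x∈U , g≈pair) = cl-Φ⊆H₁∩H₃ approx
  where
  approx : cl-Φ EvenTranslation _
  approx zero    = approx-zero (refl , refl)
  approx (suc n) = pair-approx (≈⇒≈[] g≈pair) (U⊆cl-Φ x∈U n)

level-isomorphism : ∀ m → IsoSub (suc m) m (Proj (suc m) H1 ∩ Proj (suc m) H3) (Proj m U)
level-isomorphism m = f , respects-and-reflects , into , homomorphic , onto
  where
  A = Proj (suc m) H1 ∩ Proj (suc m) H3
  f : Ω → Ω
  f g = sec g zero
  approx : ∀ {g} → A g → Approx EvenTranslation (suc m) g
  approx ((h₁ , h₁∈H₁ , g≈h₁) , (h₃ , h₃∈H₃ , g≈h₃)) = H₁∩H₃-approx (suc m) h₁∈H₁ h₃∈H₃ g≈h₁ g≈h₃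
  diagonal : ∀ {g} → A g → g ≈[ suc m ] pair (f g) (inv (f g))
  diagonal g∈A = diagonal-approx (approx g∈A)
  respects-and-reflects : ∀ g h → A g → A h → (g ≈[ suc m ] h → f g ≈[ m ] f h) × (f g ≈[ m ] f h → g ≈[ suc m ] h)
  respects-and-reflects g h g∈A h∈A =
    (λ g≈h → sec-cong g≈h zero) ,
    (λ fg≈fh → ≈[]-trans (diagonal g∈A) (≈[]-trans (pair-cong fg≈fh (inv-cong m fg≈fh)) (≈[]-sym (diagonal h∈A))))
  into : ∀ g → A g → Proj m U (f g)
  into g g∈A = approx⇒Proj Conj-a2a3⁻¹-realizes (sec₀-approx (approx g∈A))
  homomorphic : ∀ g h → A g → A h → f (g · h) ≈[ m ] (f g · f h)
  homomorphic g h g∈A h∈A w _ = cong (λ b → (sec g zero · sec h (act b zero)) w) (diagonal g∈A [] (s≤s z≤n))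
  onto : ∀ y → Proj m U y → Σ Ω λ g → A g × f g ≈[ m ] y
  onto y (u , u∈U , y≈u) =
    let (c , c-tr , u≈c) = U⊆cl-Φ u∈U m
        (d , d-even , fd≈y) = ϖ-lift (c , c-tr , ≈[]-trans y≈u u≈c)
    in Φ d , (approx⇒Proj Conj-a1-realizes (d , d-even , ≈[]-refl) , approx⇒Proj Conj-a3-realizes (d , d-even , ≈[]-refl)) ,
       fd≈y

corollary3p8 : (SameSet DerG (H1 ∩ H3) × SameSet (H1 ∩ H3) DiagU)
    × (∀ (n : ℕ) → 2 ≤ n → IsoSub n (n ∸ 1) (Proj n H1 ∩ Proj n H3) (Proj (n ∸ 1) U))
corollary3p8 =
  ((λ _ → DerG⊆H₁∩H₃ , H₁∩H₃⊆DerG) , (λ _ → H₁∩H₃⊆DiagU , DiagU⊆H₁∩H₃)) ,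
  -- level-isomorphism holds for n = 1 as well
  λ { (suc m) (s≤s _) → level-isomorphism m }
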